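{- There is no finitary first-order axiomatization that is (sound and) strongly complete for the logic over $\mathfrak C_{tree}$: there is no derivability relation $\vdash$ on node expressions such that (i) $\Gamma\vdash\varphi$ holds iff $\Gamma'\vdash\varphi$ for some finite $\Gamma'\subseteq\Gamma$ (derivations are finite), (ii) $\Gamma\vdash\varphi$ implies $\Gamma\models_{\mathfrak C_{tree}}\varphi$, and (iii) $\Gamma\models_{\mathfrak C_{tree}}\varphi$ implies $\Gamma\vdash\varphi$, for all sets $\Gamma\cup\{\varphi\}$ of node expressions.
   Context: Mono-modal setting: countable $\mathsf{Prop}$, a countably infinite set $\mathsf{Nom}$ of nominals disjoint from $\mathsf{Prop}$, one modal symbol $\mathsf a$ and one equality symbol. Path expressions $\alpha::=\mathsf a\mid @_i\mid[\varphi]\mid\alpha\beta$; node expressions $\varphi::=p\mid i\mid\neg\varphi\mid\varphi\wedge\psi\mid\langle\alpha=\beta\rangle\mid\langle\alpha\neq\beta\rangle$; $\bot:=\neg(p\vee\neg p)$. Models $\mathcal M=\langle M,\sim,R_{\mathsf a},V,\mathit{nom}\rangle$ with $\sim$ an equivalence relation on $M\neq\emptyset$, $R_{\mathsf a}\subseteq M^2$, $V:M\to2^{\mathsf{Prop}}$, $\mathit{nom}:\mathsf{Nom}\to M$. Semantics: $m,n\models\mathsf a$ iff $mR_{\mathsf a}n$; $m,n\models@_i$ iff $\mathit{nom}(i)=n$; $m,n\models[\varphi]$ iff $m=n$ and $m\models\varphi$; $m,n\models\alpha\beta$ iff some $l$ with $m,l\models\alpha$, $l,n\models\beta$; $m\models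 p$ iff $p\in V(m)$; $m\models i$ iff $\mathit{nom}(i)=m$; Booleans usual; $m\models\langle\alpha=\beta\rangle$ (resp. $\neq$) iff there are $n,l$ with $m,n\models\alpha$, $m,l\models\beta$, $n\sim l$ (resp. not). $\Gamma\models_{\mathfrak C}\varphi$ iff every point of every model in $\mathfrak C$ satisfying all of $\Gamma$ satisfies $\varphi$. $\mathfrak C_{tree}$ is the class of models where: there is a unique point with no $R_{\mathsf a}$-predecessor (the root); every point is reachable from the root in zero or more $R_{\mathsf a}$-steps; every point has at most one $R_{\mathsf a}$-predecessor; no point is reachable from itself in one or more $R_{\mathsf a}$-steps. -}

module Defs where

open import Data.Nat using (ℕ)
open import Data.Product using (Σ; _×_; ∃)
open import Data.List using (List)
open import Data.List.Membership.Propositional using (_∈_)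
open import Relation.Nullary using (¬_)
open import Relation.Binary.PropositionalEquality using (_≡_)
open import Relation.Binary.Structures using (IsEquivalence)
open import Relation.Binary.Construct.Closure.ReflexiveTransitive using (Star)
open import Relation.Binary.Construct.Closure.Transitive using (TransClosure)

PropSym : Set
PropSym = ℕ

Nom : Set
Nom = ℕ

mutual
  data PathExpr : Set where
    𝔞    : PathExpr
    at   : Nom → PathExpr
    test : NodeExpr → PathExpr
    _⨾_  : PathExpr → PathExpr → PathExpr

  data NodeExpr : Set where
    prop : PropSym → NodeExpr
    nom  : Nom → NodeExpr
    ¬'_  : NodeExpr → NodeExpr
    _∧'_ : NodeExpr → NodeExpr → NodeExpr
    ⟨_≐_⟩ : PathExpr → PathExpr → NodeExpr
    ⟨_≠_⟩ : PathExpr → PathExpr → NodeExpr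

-- Data-aware models ⟨M, ∼, R_𝔞, V, nom⟩ (M ≠ ∅ holds automatically since nom : Nom → M)
record Model : Set₁ where
  field
    M      : Set
    _∼_    : M → M → Set
    ∼-equiv : IsEquivalence _∼_
    R      : M → M → Set
    V      : M → PropSym → Set
    nomᴹ   : Nom → M

module Sem (𝓜 : Model) where
  open Model 𝓜

  mutual
    _,_⊨ₚ_ : M → M → PathExpr → Set
    m , n ⊨ₚ 𝔞 = R m n
    m , n ⊨ₚ at i = nomᴹ i ≡ n
    m , n ⊨ₚ test φ = (m ≡ n) × (m ⊨ φ)
    m , n ⊨ₚ (α ⨾ β) = Σ M λ l → (m , l ⊨ₚ α) × (l , n ⊨ₚ β)

    _⊨_ : M → NodeExpr → Set
    m ⊨ prop p = V m p
    m ⊨ nom i = nomᴹ i ≡ m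
    m ⊨ (¬' φ) = ¬ (m ⊨ φ)
    m ⊨ (φ ∧' ψ) = (m ⊨ φ) × (m ⊨ ψ)
    m ⊨ ⟨ α ≐ β ⟩ = Σ M λ n → Σ M λ l → (m , n ⊨ₚ α) × (m , l ⊨ₚ β) × (n ∼ l)
    m ⊨ ⟨ α ≠ β ⟩ = Σ M λ n → Σ M λ l → (m , n ⊨ₚ α) × (m , l ⊨ₚ β) × ¬ (n ∼ l)

IsTree : Model → Set
IsTree 𝓜 =
    (Σ M λ r → (∀ m → ¬ R m r)
             × (∀ x → (∀ m → ¬ R m x) → x ≡ r)
             × (∀ x → Star R r x))
  × (∀ m m′ x → R m x → R m′ x → m ≡ m′)
  × (∀ x → ¬ TransClosure R x x)
  where open Model 𝓜

NodeSet : Set₁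
NodeSet = NodeExpr → Set

_⊨tree_ : NodeSet → NodeExpr → Set₁
Γ ⊨tree φ = (𝓜 : Model) → IsTree 𝓜 → (m : Model.M 𝓜) →
            (∀ ψ → Γ ψ → Sem._⊨_ 𝓜 m ψ) → Sem._⊨_ 𝓜 m φ

⟦_⟧ˡ : List NodeExpr → NodeSet
⟦ L ⟧ˡ ψ = ψ ∈ L

-- A finite subset Γ' ⊆ Γ is given by a list all of whose members lie in Γ.
_⊆ˡ_ : List NodeExpr → NodeSet → Set
L ⊆ˡ Γ = ∀ ψ → ψ ∈ L → Γ ψ

Finitary : (NodeSet → NodeExpr → Set) → Set₁
Finitary _⊢_ = ∀ (Γ : NodeSet) φ →
  ((Γ ⊢ φ) → Σ (List NodeExpr) λ L → (L ⊆ˡ Γ) × (⟦ L ⟧ˡ ⊢ φ))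
  × ((Σ (List NodeExpr) λ L → (L ⊆ˡ Γ) × (⟦ L ⟧ˡ ⊢ φ)) → Γ ⊢ φ)

Sound : (NodeSet → NodeExpr → Set) → Set₁
Sound _⊢_ = ∀ (Γ : NodeSet) φ → Γ ⊢ φ → Γ ⊨tree φ

StronglyComplete : (NodeSet → NodeExpr → Set) → Set₁
StronglyComplete _⊢_ = ∀ (Γ : NodeSet) φ → Γ ⊨tree φ → Γ ⊢ φ

module Submission where

open import Defs
open import Data.Empty using (⊥; ⊥-elim)
open import Data.List using (List; []; _∷_)
open import Data.List.Membership.Propositional using (_∈_)
open import Data.List.Relation.Unary.Any using (here; there)
open import Data.Nat using (ℕ; zero; suc; _∸_; _<_; _⊔_)
open import Data.Nat.Properties using (suc-injective; +-∸-assoc; n<1+n; <-trans; n≮n; m<n⇒m<n⊔o; m<n⇒m<o⊔n)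
open import Data.Product using (_×_; Σ; ∃; _,_; proj₁)
open import Relation.Binary.Construct.Closure.ReflexiveTransitive using (Star; ε; _◅_; _◅◅_)
open import Relation.Binary.Construct.Closure.Transitive using (TransClosure; [_]; _∷_)
open import Relation.Binary.PropositionalEquality using (_≡_; refl; sym; trans; subst; isEquivalence)
open import Relation.Binary.Structures using (IsEquivalence)
open import Relation.Nullary using (¬_)

-- The nominal k+1 naming the 𝔞-parent of the nominal k, for every k, forces an
-- infinite chain of ancestors above nom 0; in a tree the finitely many steps
-- from the root to nom 0 would have to run along that chain, so the root
-- itself would have a parent. Hence these formulas are unsatisfiable over
-- trees, while finitely many of them hold on a finite line. A sound, strongly
-- complete and finitary ⊢ would make ⊨tree compact, which this refutes.

compactness : ∀ {_⊢_ : NodeSet → NodeExpr → Set} →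
  Finitary _⊢_ → Sound _⊢_ → StronglyComplete _⊢_ →
  ∀ Γ φ → Γ ⊨tree φ → Σ (List NodeExpr) λ L → L ⊆ˡ Γ × ⟦ L ⟧ˡ ⊨tree φ
compactness finitary sound complete Γ φ Γ⊨φ
  with proj₁ (finitary Γ φ) (complete Γ φ Γ⊨φ)
... | L , L⊆Γ , L⊢φ = L , L⊆Γ , sound ⟦ L ⟧ˡ φ L⊢φ

-- ⟨ π ≐ π ⟩ holds exactly when π leads somewhere, since ∼ is reflexive.
infix 25 _isParentOf_
_isParentOf_ : Nom → Nom → NodeExpr
i isParentOf j = ⟨ π ≐ π ⟩
  where π = at i ⨾ (𝔞 ⨾ test (nom j))

falsum : NodeExpr
falsum = ⟨ at 0 ≠ at 0 ⟩

module _ (𝓜 : Model) where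
  open Model 𝓜
  open Sem 𝓜
  open IsEquivalence ∼-equiv using () renaming (refl to ∼-refl)

  ⊨isParentOf⁻ : ∀ {m i j} → m ⊨ i isParentOf j → R (nomᴹ i) (nomᴹ j)
  ⊨isParentOf⁻ (_ , _ , (_ , refl , _ , r , refl , refl) , _) = r

  ⊨isParentOf⁺ : ∀ {m i j} → R (nomᴹ i) (nomᴹ j) → m ⊨ i isParentOf j
  ⊨isParentOf⁺ {i = i} {j} r = _ , _ , π , π , ∼-refl
    where π = nomᴹ i , refl , nomᴹ j , r , refl , refl

  ⊭falsum : ∀ {m} → ¬ m ⊨ falsum
  ⊭falsum (_ , _ , refl , refl , ≁) = ≁ ∼-refl

ancestor-on-chain : ∀ {A : Set} {R : A → A → Set} →
  (∀ m m′ x → R m x → R m′ x → m ≡ m′) →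
  (f : ℕ → A) → (∀ k → R (f (suc k)) (f k)) →
  ∀ {a} → Star R a (f 0) → ∃ λ k → f k ≡ a
ancestor-on-chain unique-parent f parent ε = 0 , refl
ancestor-on-chain {R = R} unique-parent f parent (a→b ◅ b↝f0)
  with ancestor-on-chain unique-parent f parent b↝f0
... | k , fk≡b = suc k , unique-parent _ _ _ (subst (R (f (suc k))) fk≡b (parent k)) a→b

module _ (𝓜 : Model) where
  open Model 𝓜

  no-infinite-ancestry : IsTree 𝓜 → (f : ℕ → M) → ¬ (∀ k → R (f (suc k)) (f k))
  no-infinite-ancestry ((root , root-parentless , _ , root-reaches) , unique-parent , _) f parent
    with ancestor-on-chain unique-parent f parent (root-reaches (f 0))
  ... | k , fk≡root = root-parentless (f (suc k)) (subst (R (f (suc k))) fk≡root (parent k))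

ancestry : NodeSet
ancestry ψ = ∃ λ k → ψ ≡ suc k isParentOf k

ancestry⊨falsum : ancestry ⊨tree falsum
ancestry⊨falsum 𝓜 tree m m⊨ancestry = ⊥-elim (no-infinite-ancestry 𝓜 tree nomᴹ parent)
  where
  open Model 𝓜
  parent : ∀ k → R (nomᴹ (suc k)) (nomᴹ k)
  parent k = ⊨isParentOf⁻ 𝓜 {m} (m⊨ancestry (suc k isParentOf k) (k , refl))

Succ : ℕ → ℕ → Set
Succ m n = n ≡ suc m

reachable-from-0 : ∀ n → Star Succ 0 n
reachable-from-0 zero = ε
reachable-from-0 (suc n) = reachable-from-0 n ◅◅ (refl ◅ ε)

Succ⁺⇒< : ∀ {m n} → TransClosure Succ m n → m < n
Succ⁺⇒< [ refl ] = n<1+n _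
Succ⁺⇒< (refl ∷ m+1<n) = <-trans (n<1+n _) (Succ⁺⇒< m+1<n)

line : ℕ → Model
line N = record
  { M = ℕ ; _∼_ = _≡_ ; ∼-equiv = isEquivalence
  ; R = Succ ; V = λ _ _ → ⊥ ; nomᴹ = N ∸_ }

line-isTree : ∀ N → IsTree (line N)
line-isTree N = (0 , (λ _ ()) , parentless⇒0 , reachable-from-0)
              , (λ _ _ _ p q → suc-injective (trans (sym p) q))
              , (λ n n<n → n≮n n (Succ⁺⇒< n<n))
  where
  parentless⇒0 : ∀ n → (∀ m → ¬ Succ m n) → n ≡ 0
  parentless⇒0 zero _ = refl
  parentless⇒0 (suc n) parentless = ⊥-elim (parentless n refl)

-- k < N keeps N ∸ suc k from being truncated to 0.
line-isParentOf : ∀ {N k} → k < N → Succ (N ∸ suc k) (N ∸ k)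
line-isParentOf k<N = +-∸-assoc 1 k<N

bounded-preimage : ∀ {A : Set} (f : ℕ → A) (L : List A) →
  (∀ x → x ∈ L → ∃ λ k → x ≡ f k) →
  ∃ λ N → ∀ x → x ∈ L → ∃ λ k → k < N × x ≡ f k
bounded-preimage f [] _ = 0 , λ _ ()
bounded-preimage f (x ∷ L) L⊆img
  with L⊆img x (here refl) | bounded-preimage f L (λ y y∈L → L⊆img y (there y∈L))
... | k , x≡fk | N , bound = suc k ⊔ N , bound′
  where
  bound′ : ∀ y → y ∈ x ∷ L → ∃ λ j → j < suc k ⊔ N × y ≡ f j
  bound′ y (here refl) = k , m<n⇒m<n⊔o N (n<1+n k) , x≡fk
  bound′ y (there y∈L) with bound y y∈L
  ... | j , j<N , y≡fj = j , m<n⇒m<o⊔n (suc k) j<N , y≡fj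

finite-ancestry-satisfiable : ∀ L → L ⊆ˡ ancestry → ¬ ⟦ L ⟧ˡ ⊨tree falsum
finite-ancestry-satisfiable L L⊆ancestry L⊨falsum
  with bounded-preimage (λ k → suc k isParentOf k) L L⊆ancestry
... | N , bound = ⊭falsum (line N) {0} (L⊨falsum (line N) (line-isTree N) 0 line⊨L)
  where
  line⊨L : ∀ ψ → ψ ∈ L → Sem._⊨_ (line N) 0 ψ
  line⊨L ψ ψ∈L with bound ψ ψ∈L
  ... | k , k<N , refl = ⊨isParentOf⁺ (line N) {0} {suc k} {k} (line-isParentOf k<N)

theorem4p3 : (_⊢_ : NodeSet → NodeExpr → Set) →
    ¬ (Finitary _⊢_ × Sound _⊢_ × StronglyComplete _⊢_)
theorem4p3 _⊢_ (finitary , sound , complete)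
  with compactness finitary sound complete ancestry falsum ancestry⊨falsum
... | L , L⊆ancestry , L⊨falsum = finite-ancestry-satisfiable L L⊆ancestry L⊨falsum
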